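{- Let $G$ be a fractionally-critical finite simple graph with $\chi_f(G)\ge 2$. Then $G$ is $2$-connected. Moreover, if $G$ has a vertex cut $\{u,v\}$, then $uv$ is not an edge of $G$.
   Context: $\chi_f$ denotes the fractional chromatic number. A graph $G$ is fractionally-critical if $\chi_f(H)<\chi_f(G)$ for every proper subgraph $H$ of $G$. -}

module Defs where

open import Data.Nat using (ℕ)
open import Data.Fin using (Fin)
open import Data.Bool using (Bool; true; false; if_then_else_; not; _∧_)
open import Data.List using (List; []; _∷_)
open import Data.Product using (Σ; ∃; _×_; _,_; proj₁; proj₂)
open import Data.Sum using (_⊎_)
open import Data.List.Relation.Unary.All using (All)
open import Data.Rational using (ℚ; 0ℚ; 1ℚ; _+_; _≤_; _<_)
open import Relation.Binary.PropositionalEquality using (_≡_)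
open import Relation.Nullary using (¬_)

record Graph : Set where
  field
    size   : ℕ
    adj    : Fin size → Fin size → Bool
    sym    : ∀ x y → adj x y ≡ adj y x
    irrefl : ∀ x → adj x x ≡ false
open Graph public

-- A "graph inside Fin n": vertex set V (as a Boolean predicate) and edge relation E.
VSet : ℕ → Set
VSet n = Fin n → Bool

ESet : ℕ → Set
ESet n = Fin n → Fin n → Bool

Independent : ∀ {n} → VSet n → ESet n → VSet n → Set
Independent V E T =
  (∀ x → T x ≡ true → V x ≡ true) ×
  (∀ x y → T x ≡ true → T y ≡ true → E x y ≡ false)

-- A weighted list of vertex sets (a fractional colouring candidate).
WList : ℕ → Set
WList n = List (ℚ × VSet n)

totalWeight : ∀ {n} → WList n → ℚ
totalWeight []             = 0ℚ
totalWeight ((w , _) ∷ ws) = w + totalWeight ws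

weightAt : ∀ {n} → WList n → Fin n → ℚ
weightAt []             v = 0ℚ
weightAt ((w , T) ∷ ws) v = (if T v then w else 0ℚ) + weightAt ws v

FracColoring : ∀ {n} → VSet n → ESet n → WList n → Set
FracColoring V E c =
  All (λ p → (0ℚ ≤ proj₁ p) × Independent V E (proj₂ p)) c ×
  (∀ v → V v ≡ true → 1ℚ ≤ weightAt c v)

-- χ_f(V' , E') < χ_f(V , E)   (the LP minimum is attained for finite graphs)
χfLess : ∀ {n} → VSet n → ESet n → VSet n → ESet n → Set
χfLess {n} V' E' V E =
  Σ (WList n) λ c' → FracColoring V' E' c' ×
    (∀ c → FracColoring V E c → totalWeight c' < totalWeight c)

χfAtLeast : ∀ {n} → VSet n → ESet n → ℚ → Set
χfAtLeast V E q = ∀ c → FracColoring V E c → q ≤ totalWeight c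

allV : ∀ {n} → VSet n
allV _ = true

IsSubgraph : (G : Graph) → VSet (size G) → ESet (size G) → Set
IsSubgraph G V' E' =
  (∀ x y → E' x y ≡ E' y x) ×
  (∀ x y → E' x y ≡ true → (V' x ≡ true) × (V' y ≡ true)) ×
  (∀ x y → E' x y ≡ true → adj G x y ≡ true)

IsProper : (G : Graph) → VSet (size G) → ESet (size G) → Set
IsProper G V' E' =
  (∃ λ x → V' x ≡ false) ⊎
  (∃ λ x → ∃ λ y → (adj G x y ≡ true) × (E' x y ≡ false))

FractionallyCritical : Graph → Set
FractionallyCritical G =
  ∀ V' E' → IsSubgraph G V' E' → IsProper G V' E' →
    χfLess V' E' allV (adj G)

data Reach (G : Graph) (W : VSet (size G)) (x : Fin (size G)) : Fin (size G) → Set where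
  here : W x ≡ true → Reach G W x x
  step : ∀ {y z} → Reach G W x y → adj G y z ≡ true → W z ≡ true → Reach G W x z

ConnectedOn : (G : Graph) → VSet (size G) → Set
ConnectedOn G W = ∀ x y → W x ≡ true → W y ≡ true → Reach G W x y

without : ∀ {n} → VSet n → VSet n
without R x = not (R x)

TwoConnected : Graph → Set
TwoConnected G =
  ConnectedOn G allV ×
  (∀ x → ConnectedOn G (λ y → not (isEq x y)))
  where
  open import Data.Fin using (_≟_)
  open import Relation.Nullary.Decidable using (⌊_⌋)
  isEq : Fin (size G) → Fin (size G) → Bool
  isEq a b = ⌊ a ≟ b ⌋

minus2 : (G : Graph) → Fin (size G) → Fin (size G) → VSet (size G)
minus2 G u v y = not (⌊ u ≟ y ⌋) ∧ not (⌊ v ≟ y ⌋)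
  where
  open import Data.Fin using (_≟_)
  open import Relation.Nullary.Decidable using (⌊_⌋)

IsVertexCut2 : (G : Graph) → Fin (size G) → Fin (size G) → Set
IsVertexCut2 G u v = ¬ (u ≡ v) × ¬ ConnectedOn G (minus2 G u v)

module Submission where

-- Idea.  Let S be a clique of G and suppose G − S is disconnected, with x, y in different
-- components; let R be the component of x, A = S ∪ R and B = V(G) ∖ R.  The induced subgraphs
-- G[A] (missing y) and G[B] (missing x) are proper, so by criticality they have fractional
-- colourings c₁, c₂ strictly lighter than every fractional colouring of G.  Each independent
-- set meets the clique S in at most one vertex, so for every s ∈ S we may cut out of c₁ and
-- of c₂ exactly one unit of weight on sets through s.  Merging the two units for s by
-- overlaying them as intervals ("zipper merge"), and likewise the remainders, produces sets
-- T₁ ∪ T₂ that agree on S; since no edge joins R to B ∖ S these are independent in G.  The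
-- result is a fractional colouring of G of weight at most max(w(c₁), w(c₂)): contradiction.

open import Defs hiding (sym)
open import Data.Bool using (Bool; true; false; if_then_else_; not; _∧_; _∨_)
open import Data.Bool.Properties using (∨-comm; ∨-zeroʳ; ∧-zeroʳ; ∧-identityʳ; T-≡) renaming (_≟_ to _≟ᵇ_)
open import Data.Empty using (⊥; ⊥-elim)
open import Data.Fin using (Fin; _≟_)
open import Data.Fin.Properties using () renaming (any? to any-vertex?)
open import Data.Fin.Subset as Subset using (Subset; ⁅_⁆)
open import Data.Fin.Subset.Properties using (x∈p⇒p-x⊂p; p─q⊆p; x∈p∧x∉q⇒x∈p─q; x∈⁅y⁆⇒x≡y)
open import Data.Fin.Subset.Induction using (⊂-wellFounded)
open import Data.List using (List; []; _∷_; _++_)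
open import Data.List.Membership.Propositional using (_∈_; _∉_)
open import Data.List.Relation.Unary.All as All using (All; []; _∷_)
open import Data.List.Relation.Unary.All.Properties using (++⁺)
open import Data.List.Relation.Unary.Any using (here; there; any?)
open import Data.List.Relation.Unary.Unique.Propositional using (Unique; []; _∷_)
open import Data.Nat using (ℕ)
open import Data.Product using (∃; _×_; _,_; proj₁; proj₂)
open import Data.Rational using (ℚ; 0ℚ; 1ℚ; _+_; _-_; -_; _≤_; _<_; _⊔_)
open import Data.Rational.Properties
  using (≤-refl; ≤-trans; ≤-reflexive; ≤-antisym; _≤?_; ≰⇒>; <⇒≤; <-≤-trans; <-irrefl; +-mono-≤; +-monoˡ-≤;
         +-monoʳ-≤; +-identityˡ; +-identityʳ; +-assoc; positive⁻¹; ⊔-sel; p≤p⊔q; p≤q⊔p; module ≤-Reasoning)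
open import Data.Rational.Solver using (module +-*-Solver)
open import Data.Sum using (_⊎_; inj₁; inj₂)
open import Data.Unit using (⊤; tt)
open import Data.Vec using (lookup; tabulate)
open import Data.Vec.Properties using ([]=⇒lookup; lookup⇒[]=; lookup∘tabulate)
open import Function using (_∘_)
open import Function.Bundles using (_⇔_; mk⇔; Equivalence)
open import Induction.WellFounded using (Acc; acc)
open import Relation.Binary.PropositionalEquality
  using (_≡_; _≢_; refl; sym; trans; cong; cong₂; subst; subst₂; module ≡-Reasoning)
open import Relation.Nullary using (¬_; Dec; yes; no)
open import Relation.Nullary.Decidable using (⌊_⌋; map′; _×-dec_; toWitness; fromWitness)

open +-*-Solver using (solve; _:=_; _:+_; _:-_)

a+[b-a]≡b : ∀ a b → a + (b - a) ≡ b
a+[b-a]≡b = solve 2 (λ a b → a :+ (b :- a) := b) refl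

[a+b]-a≡b : ∀ a b → (a + b) - a ≡ b
[a+b]-a≡b = solve 2 (λ a b → (a :+ b) :- a := b) refl

a+[[b-a]+c]≡b+c : ∀ a b c → a + ((b - a) + c) ≡ b + c
a+[[b-a]+c]≡b+c = solve 3 (λ a b c → a :+ ((b :- a) :+ c) := b :+ c) refl

sum≤⇒≤diff : ∀ {a b c} → a + b ≤ c → b ≤ c - a
sum≤⇒≤diff {a} {b} {c} a+b≤c = begin
  b             ≡⟨ sym ([a+b]-a≡b a b) ⟩
  (a + b) - a   ≤⟨ +-monoˡ-≤ (- a) a+b≤c ⟩
  c - a         ∎
  where open ≤-Reasoning

≤diff⇒sum≤ : ∀ {a b c} → b ≤ c - a → a + b ≤ c
≤diff⇒sum≤ {a} {b} {c} b≤c-a = begin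
  a + b         ≤⟨ +-monoʳ-≤ a b≤c-a ⟩
  a + (c - a)   ≡⟨ a+[b-a]≡b a c ⟩
  c             ∎
  where open ≤-Reasoning

≤sum⇒diff≤ : ∀ {a b c} → c ≤ a + b → c - a ≤ b
≤sum⇒diff≤ {a} {b} {c} c≤a+b = begin
  c - a         ≤⟨ +-monoˡ-≤ (- a) c≤a+b ⟩
  (a + b) - a   ≡⟨ [a+b]-a≡b a b ⟩
  b             ∎
  where open ≤-Reasoning

≤⇒0≤-minus : ∀ {a b} → a ≤ b → 0ℚ ≤ b - a
≤⇒0≤-minus {a} {b} a≤b = sum≤⇒≤diff (subst (_≤ b) (sym (+-identityʳ a)) a≤b)

≰⇒0≤-minus : ∀ {a b} → ¬ a ≤ b → 0ℚ ≤ a - b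
≰⇒0≤-minus a≰b = ≤⇒0≤-minus (<⇒≤ (≰⇒> a≰b))

≤+nonnegʳ : ∀ a {b} → 0ℚ ≤ b → a ≤ a + b
≤+nonnegʳ a {b} 0≤b = subst (_≤ a + b) (+-identityʳ a) (+-monoʳ-≤ a 0≤b)

≤+nonnegˡ : ∀ {a} b → 0ℚ ≤ a → b ≤ a + b
≤+nonnegˡ {a} b 0≤a = subst (_≤ a + b) (+-identityˡ b) (+-monoˡ-≤ b 0≤a)

0≤1 : 0ℚ ≤ 1ℚ
0≤1 = <⇒≤ (positive⁻¹ 1ℚ)

true≢false : true ≢ false
true≢false ()

infix 4 _⊆_
_⊆_ : ∀ {n} → VSet n → VSet n → Set
W ⊆ W' = ∀ v → W v ≡ true → W' v ≡ true

module _ {n : ℕ} where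

  infixr 6 _∪_
  _∪_ : VSet n → VSet n → VSet n
  (T ∪ T') v = T v ∨ T' v

  weightIf : Bool → ℚ → ℚ
  weightIf b w = if b then w else 0ℚ

  mass : (VSet n → Bool) → WList n → ℚ
  mass φ []             = 0ℚ
  mass φ ((w , T) ∷ c) = weightIf (φ T) w + mass φ c

  everything : VSet n → Bool
  everything _ = true

  contains : Fin n → VSet n → Bool
  contains v T = T v

  totalWeight≡mass : ∀ c → totalWeight c ≡ mass everything c
  totalWeight≡mass []             = refl
  totalWeight≡mass ((w , _) ∷ c) = cong (w +_) (totalWeight≡mass c)

  weightAt≡mass : ∀ c v → weightAt c v ≡ mass (contains v) c
  weightAt≡mass []             v = refl
  weightAt≡mass ((w , T) ∷ c) v = cong (weightIf (T v) w +_) (weightAt≡mass c v)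

  Family : (VSet n → Set) → WList n → Set
  Family Q = All (λ p → 0ℚ ≤ proj₁ p × Q (proj₂ p))

  weightIf-nonneg : ∀ b {w} → 0ℚ ≤ w → 0ℚ ≤ weightIf b w
  weightIf-nonneg true  0≤w = 0≤w
  weightIf-nonneg false _   = ≤-refl

  mass-nonneg : ∀ {Q} φ {c} → Family Q c → 0ℚ ≤ mass φ c
  mass-nonneg φ []                    = ≤-refl
  mass-nonneg φ {(_ , T) ∷ _} ((0≤w , _) ∷ fam) = +-mono-≤ (weightIf-nonneg (φ T) 0≤w) (mass-nonneg φ fam)

  mass-++ : ∀ φ c d → mass φ (c ++ d) ≡ mass φ c + mass φ d
  mass-++ φ []             d = sym (+-identityˡ (mass φ d))
  mass-++ φ ((w , T) ∷ c) d = trans (cong (weightIf (φ T) w +_) (mass-++ φ c d))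
                                     (sym (+-assoc (weightIf (φ T) w) (mass φ c) (mass φ d)))

  mass-all : ∀ φ c → All (λ p → φ (proj₂ p) ≡ true) c → mass φ c ≡ mass everything c
  mass-all φ []             []          = refl
  mass-all φ ((w , T) ∷ c) (φT ∷ all) rewrite φT = cong (w +_) (mass-all φ c all)

  mass-none : ∀ φ c → All (λ p → φ (proj₂ p) ≡ false) c → mass φ c ≡ 0ℚ
  mass-none φ []             []           = refl
  mass-none φ ((w , T) ∷ c) (¬φT ∷ none) rewrite ¬φT | mass-none φ c none = +-identityˡ 0ℚ

  -- Laying both lists out as consecutive intervals
  -- of lengths given by the weights, the output lists the union of the two sets over each
  -- common piece; the head (w , T) of the first list is the piece currently being cut.
  mergeFrom : ℚ × VSet n → WList n → WList n → WList n
  mergeFrom h R [] = h ∷ R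
  mergeFrom (w , T) R ((w' , T') ∷ O) with w ≤? w'
  ... | yes _ = (w , T ∪ T') ∷ mergeFrom (w' - w , T') O R
  ... | no _  = (w' , T ∪ T') ∷ mergeFrom (w - w' , T) R O

  merge : WList n → WList n → WList n
  merge []      d = d
  merge (h ∷ c) d = mergeFrom h c d

  mergeFrom-total : ∀ h R O X → mass everything (h ∷ R) ≤ X → mass everything O ≤ X →
    mass everything (mergeFrom h R O) ≤ X
  mergeFrom-total h R [] X hR hO = hR
  mergeFrom-total (w , T) R ((w' , T') ∷ O) X hR hO with w ≤? w'
  ... | yes _ = ≤diff⇒sum≤ (mergeFrom-total (w' - w , T') O R (X - w)
                  (sum≤⇒≤diff (subst (_≤ X) (sym (a+[[b-a]+c]≡b+c w w' (mass everything O))) hO))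
                  (sum≤⇒≤diff hR))
  ... | no _  = ≤diff⇒sum≤ (mergeFrom-total (w - w' , T) R O (X - w')
                  (sum≤⇒≤diff (subst (_≤ X) (sym (a+[[b-a]+c]≡b+c w' w (mass everything R))) hR))
                  (sum≤⇒≤diff hO))

  merge-total : ∀ c d X → mass everything c ≤ X → mass everything d ≤ X → mass everything (merge c d) ≤ X
  merge-total []      d X _  hd = hd
  merge-total (h ∷ c) d X hc hd = mergeFrom-total h c d X hc hd

  -- arithmetic of a single merge step: enlarging the selecting bit can only help, and a piece
  -- of weight w' of which w is paid into the current output set still pays in full
  weightIf-mono : ∀ {b b'} → (b ≡ true → b' ≡ true) → ∀ {w} → 0ℚ ≤ w → weightIf b w ≤ weightIf b' w
  weightIf-mono {false} {b'} _    0≤w = weightIf-nonneg b' 0≤w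
  weightIf-mono {true}  b⇒b' 0≤w rewrite b⇒b' refl = ≤-refl

  weightIf-piece : ∀ {b b'} → (b ≡ true → b' ≡ true) → ∀ {w w' m M} → 0ℚ ≤ w →
    weightIf b (w' - w) + m ≤ M → weightIf b w' + m ≤ weightIf b' w + M
  weightIf-piece {false} {b'} _ {M = M} 0≤w m≤M = ≤-trans m≤M (≤+nonnegˡ M (weightIf-nonneg b' 0≤w))
  weightIf-piece {true} b⇒b' {w} {w'} {m} {M} _ rest≤M rewrite b⇒b' refl = begin
    w' + m              ≡⟨ sym (a+[[b-a]+c]≡b+c w w' m) ⟩
    w + ((w' - w) + m)  ≤⟨ +-monoʳ-≤ w rest≤M ⟩
    w + M               ∎
    where open ≤-Reasoning

  ∨-introˡ : ∀ a b → a ≡ true → a ∨ b ≡ true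
  ∨-introˡ true _ _ = refl

  ∨-introʳ : ∀ a b → b ≡ true → a ∨ b ≡ true
  ∨-introʳ a true _ = ∨-comm a true

  mergeFrom-weight : ∀ {Q₁ Q₂} h R O v → Family Q₁ (h ∷ R) → Family Q₂ O →
    (mass (contains v) (h ∷ R) ≤ mass (contains v) (mergeFrom h R O)) ×
    (mass (contains v) O ≤ mass (contains v) (mergeFrom h R O))
  mergeFrom-weight h R [] v famR famO = ≤-refl , mass-nonneg (contains v) famR
  mergeFrom-weight (w , T) R ((w' , T') ∷ O) v ((0≤w , qT) ∷ famR) ((0≤w' , qT') ∷ famO) with w ≤? w'
  ... | yes w≤w' =
    let (fromO , fromR) = mergeFrom-weight (w' - w , T') O R v ((≤⇒0≤-minus w≤w' , qT') ∷ famO) famR in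
    +-mono-≤ (weightIf-mono (∨-introˡ (T v) (T' v)) 0≤w) fromR ,
    weightIf-piece (∨-introʳ (T v) (T' v)) 0≤w fromO
  ... | no w≰w' =
    let (fromR , fromO) = mergeFrom-weight (w - w' , T) R O v ((≰⇒0≤-minus w≰w' , qT) ∷ famR) famO in
    weightIf-piece (∨-introˡ (T v) (T' v)) 0≤w' fromR ,
    +-mono-≤ (weightIf-mono (∨-introʳ (T v) (T' v)) 0≤w') fromO

  merge-weight : ∀ {Q₁ Q₂} c d v → Family Q₁ c → Family Q₂ d →
    (mass (contains v) c ≤ mass (contains v) (merge c d)) × (mass (contains v) d ≤ mass (contains v) (merge c d))
  merge-weight []      d v _    famd = mass-nonneg (contains v) famd , ≤-refl
  merge-weight (h ∷ c) d v famc famd = mergeFrom-weight h c d v famc famd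

  -- Each output set of the merge is a P-set, a Q-set, or the union of a P-set with a Q-set.
  -- Since mergeFrom alternates which list supplies the head, both orders of union occur.
  mergeFrom-family : ∀ {P Q Good : VSet n → Set} → (∀ T → P T → Good T) → (∀ T → Q T → Good T) →
    (∀ T T' → P T → Q T' → Good (T ∪ T')) → (∀ T T' → Q T → P T' → Good (T ∪ T')) →
    ∀ h R O → Family P (h ∷ R) → Family Q O → Family Good (mergeFrom h R O)
  mergeFrom-family P⇒G Q⇒G PQ QP h R [] famR [] = All.map (λ (0≤w , pT) → 0≤w , P⇒G _ pT) famR
  mergeFrom-family P⇒G Q⇒G PQ QP (w , T) R ((w' , T') ∷ O) ((0≤w , pT) ∷ famR) ((0≤w' , qT') ∷ famO)
    with w ≤? w'
  ... | yes w≤w' = (0≤w , PQ T T' pT qT') ∷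
    mergeFrom-family Q⇒G P⇒G QP PQ (w' - w , T') O R ((≤⇒0≤-minus w≤w' , qT') ∷ famO) famR
  ... | no w≰w'  = (0≤w' , PQ T T' pT qT') ∷
    mergeFrom-family P⇒G Q⇒G PQ QP (w - w' , T) R O ((≰⇒0≤-minus w≰w' , pT) ∷ famR) famO

  merge-family : ∀ {P Q Good : VSet n → Set} → (∀ T T' → Good (T ∪ T') → Good (T' ∪ T)) →
    (∀ T → P T → Good T) → (∀ T → Q T → Good T) → (∀ T T' → P T → Q T' → Good (T ∪ T')) →
    ∀ c d → Family P c → Family Q d → Family Good (merge c d)
  merge-family Good-comm P⇒G Q⇒G PQ [] d [] famd = All.map (λ (0≤w , qT) → 0≤w , Q⇒G _ qT) famd
  merge-family Good-comm P⇒G Q⇒G PQ (h ∷ c) d famc famd =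
    mergeFrom-family P⇒G Q⇒G PQ (λ T T' qT pT' → Good-comm T' T (PQ T' T pT' qT)) h c d famc famd

  merge-nonneg : ∀ {P Q} c d → Family P c → Family Q d → Family (λ _ → ⊤) (merge c d)
  merge-nonneg c d = merge-family (λ _ _ _ → tt) (λ _ _ → tt) (λ _ _ → tt) (λ _ _ _ _ → tt) c d

  _∖_ : VSet n → Fin n → VSet n
  (T ∖ s) v = T v ∧ not ⌊ s ≟ v ⌋

  ∖-⊆ : ∀ T s → T ∖ s ⊆ T
  ∖-⊆ T s v T∖s∋v with T v
  ... | true = refl

  ∖-self : ∀ T s → (T ∖ s) s ≡ false
  ∖-self T s with s ≟ s
  ... | yes _   = ∧-zeroʳ (T s)
  ... | no s≢s = ⊥-elim (s≢s refl)

  ∖-other : ∀ T {s v} → s ≢ v → (T ∖ s) v ≡ T v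
  ∖-other T {s} {v} s≢v with s ≟ v
  ... | yes s≡v = ⊥-elim (s≢v s≡v)
  ... | no _    = ∧-identityʳ (T v)

  -- Splitting off the sets through s.  taken s b c consists of the sets of c containing s,
  -- truncated so that their total weight is b (the set at which the budget b runs out is cut
  -- in two); rest s b c is everything else, with s deleted from the cut-off remainder.
  taken : Fin n → ℚ → WList n → WList n
  taken s b [] = []
  taken s b ((w , T) ∷ c) with T s | w ≤? b
  ... | false | _     = taken s b c
  ... | true  | yes _ = (w , T) ∷ taken s (b - w) c
  ... | true  | no _  = (b , T) ∷ taken s 0ℚ c

  rest : Fin n → ℚ → WList n → WList n
  rest s b [] = []
  rest s b ((w , T) ∷ c) with T s | w ≤? b
  ... | false | _     = (w , T) ∷ rest s b c
  ... | true  | yes _ = rest s (b - w) c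
  ... | true  | no _  = (w - b , T ∖ s) ∷ rest s 0ℚ c

  weightIf-+ : ∀ a b w → weightIf a b + weightIf a (w - b) ≡ weightIf a w
  weightIf-+ true  b w = a+[b-a]≡b b w
  weightIf-+ false b w = +-identityˡ 0ℚ

  split-mass : ∀ φ s → (∀ T → φ (T ∖ s) ≡ φ T) →
    ∀ b c → mass φ (taken s b c) + mass φ (rest s b c) ≡ mass φ c
  split-mass φ s φ-ignores-s b [] = +-identityˡ 0ℚ
  split-mass φ s φ-ignores-s b ((w , T) ∷ c) with T s | w ≤? b
  ... | false | _ = trans
    (solve 3 (λ t x r → t :+ (x :+ r) := x :+ (t :+ r)) refl (mass φ (taken s b c)) (weightIf (φ T) w) (mass φ (rest s b c)))
    (cong (weightIf (φ T) w +_) (split-mass φ s φ-ignores-s b c))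
  ... | true | yes _ = trans
    (+-assoc (weightIf (φ T) w) (mass φ (taken s (b - w) c)) (mass φ (rest s (b - w) c)))
    (cong (weightIf (φ T) w +_) (split-mass φ s φ-ignores-s (b - w) c))
  ... | true | no _ rewrite φ-ignores-s T = begin
    (weightIf (φ T) b + t) + (weightIf (φ T) (w - b) + r)   ≡⟨ solve 4 (λ x t y r → (x :+ t) :+ (y :+ r) := (x :+ y) :+ (t :+ r))
                                                                  refl (weightIf (φ T) b) t (weightIf (φ T) (w - b)) r ⟩
    (weightIf (φ T) b + weightIf (φ T) (w - b)) + (t + r)   ≡⟨ cong₂ _+_ (weightIf-+ (φ T) b w) (split-mass φ s φ-ignores-s 0ℚ c) ⟩
    weightIf (φ T) w + mass φ c                              ∎
    where
    open ≡-Reasoning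
    t r : ℚ
    t = mass φ (taken s 0ℚ c)
    r = mass φ (rest s 0ℚ c)

  taken-total : ∀ {Q} s b c → Family Q c → 0ℚ ≤ b → b ≤ mass (contains s) c → mass everything (taken s b c) ≡ b
  taken-total s b [] _ 0≤b b≤0 = ≤-antisym 0≤b b≤0
  taken-total s b ((w , T) ∷ c) ((0≤w , _) ∷ fam) 0≤b b≤mass with T s | w ≤? b
  ... | false | _ = taken-total s b c fam 0≤b (subst (b ≤_) (+-identityˡ _) b≤mass)
  ... | true | yes w≤b = trans (cong (w +_) (taken-total s (b - w) c fam (≤⇒0≤-minus w≤b) (≤sum⇒diff≤ b≤mass)))
                               (a+[b-a]≡b w b)
  ... | true | no _ = trans (cong (b +_) (taken-total s 0ℚ c fam ≤-refl (mass-nonneg (contains s) fam)))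
                            (+-identityʳ b)

  taken-family : ∀ {Q} s b c → Family Q c → 0ℚ ≤ b → Family (λ T → Q T × T s ≡ true) (taken s b c)
  taken-family s b [] [] _ = []
  taken-family s b ((w , T) ∷ c) ((0≤w , qT) ∷ fam) 0≤b with T s in Ts | w ≤? b
  ... | false | _ = taken-family s b c fam 0≤b
  ... | true | yes w≤b = (0≤w , qT , Ts) ∷ taken-family s (b - w) c fam (≤⇒0≤-minus w≤b)
  ... | true | no _ = (0≤b , qT , Ts) ∷ taken-family s 0ℚ c fam ≤-refl

  DownClosed : (VSet n → Set) → Set
  DownClosed Q = ∀ {T T'} → T' ⊆ T → Q T → Q T'

  rest-family : ∀ {Q} → DownClosed Q → ∀ s b c → Family Q c → Family (λ T → Q T × T s ≡ false) (rest s b c)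
  rest-family down s b [] [] = []
  rest-family down s b ((w , T) ∷ c) ((0≤w , qT) ∷ fam) with T s in Ts | w ≤? b
  ... | false | _ = (0≤w , qT , Ts) ∷ rest-family down s b c fam
  ... | true | yes _ = rest-family down s (b - w) c fam
  ... | true | no w≰b = (≰⇒0≤-minus w≰b , down (∖-⊆ T s) qT , ∖-self T s) ∷ rest-family down s 0ℚ c fam

  AtMostOnce : List (Fin n) → VSet n → Set
  AtMostOnce S T = ∀ {a b} → a ∈ S → b ∈ S → T a ≡ true → T b ≡ true → a ≡ b

  Agree : List (Fin n) → VSet n → VSet n → Set
  Agree S T T' = ∀ {v} → v ∈ S → T v ≡ T' v

  once-profile : ∀ {S T s} → AtMostOnce S T → s ∈ S → T s ≡ true → ∀ {v} → v ∈ S → T v ≡ ⌊ s ≟ v ⌋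
  once-profile {T = T} {s} once s∈S Ts {v} v∈S with s ≟ v
  ... | yes refl = Ts
  ... | no s≢v with T v in Tv
  ...   | false = refl
  ...   | true  = ⊥-elim (s≢v (once s∈S v∈S Ts Tv))

  record Input (Q : VSet n → Set) (S : List (Fin n)) (c : WList n) : Set where
    field
      down   : DownClosed Q
      once   : ∀ {T} → Q T → AtMostOnce S T
      family : Family Q c
      covers : ∀ {v} → v ∈ S → 1ℚ ≤ mass (contains v) c

  -- Merge two coverings of S = s₁ ∷ s₂ ∷ …  block by block: first the sets through s₁ (one
  -- unit of weight from each list), then those through s₂, …, and finally the rest.  Within a
  -- block the two merged sets meet S in the same vertex.
  mergeAlong : List (Fin n) → WList n → WList n → WList n
  mergeAlong []      c₁ c₂ = merge c₁ c₂
  mergeAlong (s ∷ S) c₁ c₂ = merge (taken s 1ℚ c₁) (taken s 1ℚ c₂) ++ mergeAlong S (rest s 1ℚ c₁) (rest s 1ℚ c₂)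

  module Split {Q s S c} (s∉S : All (s ≢_) S) (I : Input Q (s ∷ S) c) where
    open Input I

    taken-unit : mass everything (taken s 1ℚ c) ≡ 1ℚ
    taken-unit = taken-total s 1ℚ c family 0≤1 (covers (here refl))

    taken-through-s : Family (λ T → Q T × T s ≡ true) (taken s 1ℚ c)
    taken-through-s = taken-family s 1ℚ c family 0≤1

    taken-misses : ∀ {v} → v ∈ S → mass (contains v) (taken s 1ℚ c) ≡ 0ℚ
    taken-misses {v} v∈S = mass-none (contains v) _ (All.map misses taken-through-s)
      where
      misses : ∀ {p} → 0ℚ ≤ proj₁ p × Q (proj₂ p) × proj₂ p s ≡ true → proj₂ p v ≡ false
      misses (_ , qT , Ts) = trans (once-profile (once qT) (here refl) Ts (there v∈S)) (s≢v⇒false (All.lookup s∉S v∈S))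
        where
        s≢v⇒false : s ≢ v → ⌊ s ≟ v ⌋ ≡ false
        s≢v⇒false s≢v with s ≟ v
        ... | yes s≡v = ⊥-elim (s≢v s≡v)
        ... | no _    = refl

    split-at : ∀ {v} → s ≢ v → mass (contains v) (taken s 1ℚ c) + mass (contains v) (rest s 1ℚ c) ≡ mass (contains v) c
    split-at s≢v = split-mass (contains _) s (λ T → ∖-other T s≢v) 1ℚ c

    rest-total : mass everything c ≡ 1ℚ + mass everything (rest s 1ℚ c)
    rest-total = trans (sym (split-mass everything s (λ _ → refl) 1ℚ c))
                       (cong (_+ mass everything (rest s 1ℚ c)) taken-unit)

    rest-input : Input (λ T → Q T × T s ≡ false) S (rest s 1ℚ c)
    rest-input = record
      { down   = λ T'⊆T (qT , Ts) → down T'⊆T qT , avoid T'⊆T Ts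
      ; once   = λ (qT , _) a∈S b∈S → once qT (there a∈S) (there b∈S)
      ; family = rest-family down s 1ℚ c family
      ; covers = λ {v} v∈S → begin
          1ℚ                                                            ≤⟨ covers (there v∈S) ⟩
          mass (contains v) c                                           ≡⟨ sym (split-at (All.lookup s∉S v∈S)) ⟩
          mass (contains v) (taken s 1ℚ c) + mass (contains v) (rest s 1ℚ c) ≡⟨ cong (_+ mass (contains v) (rest s 1ℚ c)) (taken-misses v∈S) ⟩
          0ℚ + mass (contains v) (rest s 1ℚ c)                          ≡⟨ +-identityˡ _ ⟩
          mass (contains v) (rest s 1ℚ c)                               ∎
      }
      where
      open ≤-Reasoning
      avoid : ∀ {T T'} → T' ⊆ T → T s ≡ false → T' s ≡ false
      avoid {T' = T'} T'⊆T Ts with T' s in T's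
      ... | false = refl
      ... | true  = trans (sym (T'⊆T s T's)) Ts

  mergeAlong-family : ∀ {Q₁ Q₂ Good : VSet n → Set} S {c₁ c₂} → Unique S → Input Q₁ S c₁ → Input Q₂ S c₂ →
    (∀ T T' → Good (T ∪ T') → Good (T' ∪ T)) → (∀ T → Q₁ T → Good T) → (∀ T → Q₂ T → Good T) →
    (∀ T₁ T₂ → Q₁ T₁ → Q₂ T₂ → Agree S T₁ T₂ → Good (T₁ ∪ T₂)) →
    Family Good (mergeAlong S c₁ c₂)
  mergeAlong-family [] {c₁} {c₂} _ I₁ I₂ Good-comm Q₁⇒G Q₂⇒G glue =
    merge-family Good-comm Q₁⇒G Q₂⇒G (λ T₁ T₂ q₁ q₂ → glue T₁ T₂ q₁ q₂ λ ()) c₁ c₂ (Input.family I₁) (Input.family I₂)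
  mergeAlong-family {Q₁} {Q₂} {Good} (s ∷ S) {c₁} {c₂} (s∉S ∷ uniq) I₁ I₂ Good-comm Q₁⇒G Q₂⇒G glue = ++⁺
    (merge-family Good-comm (λ T (q , _) → Q₁⇒G T q) (λ T (q , _) → Q₂⇒G T q) glue-through-s
      (taken s 1ℚ c₁) (taken s 1ℚ c₂) (Split.taken-through-s s∉S I₁) (Split.taken-through-s s∉S I₂))
    (mergeAlong-family S uniq (Split.rest-input s∉S I₁) (Split.rest-input s∉S I₂)
      Good-comm (λ T (q , _) → Q₁⇒G T q) (λ T (q , _) → Q₂⇒G T q) glue-avoiding-s)
    where
    glue-through-s : ∀ T₁ T₂ → Q₁ T₁ × T₁ s ≡ true → Q₂ T₂ × T₂ s ≡ true → Good (T₁ ∪ T₂)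
    glue-through-s T₁ T₂ (q₁ , T₁s) (q₂ , T₂s) = glue T₁ T₂ q₁ q₂ λ v∈S →
      trans (once-profile (Input.once I₁ q₁) (here refl) T₁s v∈S)
            (sym (once-profile (Input.once I₂ q₂) (here refl) T₂s v∈S))
    glue-avoiding-s : ∀ T₁ T₂ → Q₁ T₁ × T₁ s ≡ false → Q₂ T₂ × T₂ s ≡ false → Agree S T₁ T₂ → Good (T₁ ∪ T₂)
    glue-avoiding-s T₁ T₂ (q₁ , T₁s) (q₂ , T₂s) agree = glue T₁ T₂ q₁ q₂ λ where
      (here refl)  → trans T₁s (sym T₂s)
      (there v∈S) → agree v∈S

  mergeAlong-nonneg : ∀ {Q₁ Q₂} S {c₁ c₂} → Unique S → Input Q₁ S c₁ → Input Q₂ S c₂ →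
    Family (λ _ → ⊤) (mergeAlong S c₁ c₂)
  mergeAlong-nonneg S uniq I₁ I₂ = mergeAlong-family S uniq I₁ I₂ (λ _ _ _ → tt) (λ _ _ → tt) (λ _ _ → tt) (λ _ _ _ _ _ → tt)

  mergeAlong-total : ∀ {Q₁ Q₂} S {c₁ c₂} → Unique S → Input Q₁ S c₁ → Input Q₂ S c₂ → ∀ X →
    mass everything c₁ ≤ X → mass everything c₂ ≤ X → mass everything (mergeAlong S c₁ c₂) ≤ X
  mergeAlong-total [] {c₁} {c₂} _ _ _ X c₁≤X c₂≤X = merge-total c₁ c₂ X c₁≤X c₂≤X
  mergeAlong-total (s ∷ S) {c₁} {c₂} (s∉S ∷ uniq) I₁ I₂ X c₁≤X c₂≤X = begin
    mass everything (merge t₁ t₂ ++ M)        ≡⟨ mass-++ everything (merge t₁ t₂) M ⟩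
    mass everything (merge t₁ t₂) + mass everything M
      ≤⟨ +-mono-≤ (merge-total t₁ t₂ 1ℚ (≤-reflexive (Split.taken-unit s∉S I₁)) (≤-reflexive (Split.taken-unit s∉S I₂)))
                  (mergeAlong-total S uniq (Split.rest-input s∉S I₁) (Split.rest-input s∉S I₂) (X - 1ℚ)
                    (rest≤ I₁ c₁≤X) (rest≤ I₂ c₂≤X)) ⟩
    1ℚ + (X - 1ℚ)                              ≡⟨ a+[b-a]≡b 1ℚ X ⟩
    X                                          ∎
    where
    open ≤-Reasoning
    t₁ t₂ M : WList n
    t₁ = taken s 1ℚ c₁
    t₂ = taken s 1ℚ c₂
    M = mergeAlong S (rest s 1ℚ c₁) (rest s 1ℚ c₂)
    rest≤ : ∀ {Q c} → Input Q (s ∷ S) c → mass everything c ≤ X → mass everything (rest s 1ℚ c) ≤ X - 1ℚ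
    rest≤ I c≤X = sum≤⇒≤diff {1ℚ} (subst (_≤ X) (Split.rest-total s∉S I) c≤X)

  mergeAlong-weight : ∀ {Q₁ Q₂} S {c₁ c₂} → Unique S → Input Q₁ S c₁ → Input Q₂ S c₂ → ∀ {v} → v ∉ S →
    (mass (contains v) c₁ ≤ mass (contains v) (mergeAlong S c₁ c₂)) ×
    (mass (contains v) c₂ ≤ mass (contains v) (mergeAlong S c₁ c₂))
  mergeAlong-weight [] {c₁} {c₂} _ I₁ I₂ {v} _ = merge-weight c₁ c₂ v (Input.family I₁) (Input.family I₂)
  mergeAlong-weight (s ∷ S) {c₁} {c₂} (s∉S ∷ uniq) I₁ I₂ {v} v∉s∷S =
    through I₁ (proj₁ fromBlock) (proj₁ fromRest) , through I₂ (proj₂ fromBlock) (proj₂ fromRest)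
    where
    open ≤-Reasoning
    s≢v : s ≢ v
    s≢v s≡v = v∉s∷S (here (sym s≡v))
    t₁ t₂ M : WList n
    t₁ = taken s 1ℚ c₁
    t₂ = taken s 1ℚ c₂
    M = mergeAlong S (rest s 1ℚ c₁) (rest s 1ℚ c₂)
    fromBlock : (mass (contains v) t₁ ≤ mass (contains v) (merge t₁ t₂)) × (mass (contains v) t₂ ≤ mass (contains v) (merge t₁ t₂))
    fromBlock = merge-weight t₁ t₂ v (Split.taken-through-s s∉S I₁) (Split.taken-through-s s∉S I₂)
    fromRest : (mass (contains v) (rest s 1ℚ c₁) ≤ mass (contains v) M) × (mass (contains v) (rest s 1ℚ c₂) ≤ mass (contains v) M)
    fromRest = mergeAlong-weight S uniq (Split.rest-input s∉S I₁) (Split.rest-input s∉S I₂) (v∉s∷S ∘ there)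
    through : ∀ {Q c} → Input Q (s ∷ S) c →
      mass (contains v) (taken s 1ℚ c) ≤ mass (contains v) (merge t₁ t₂) →
      mass (contains v) (rest s 1ℚ c) ≤ mass (contains v) M →
      mass (contains v) c ≤ mass (contains v) (merge t₁ t₂ ++ M)
    through {c = c} I fromT fromR = begin
      mass (contains v) c                                                    ≡⟨ sym (Split.split-at s∉S I s≢v) ⟩
      mass (contains v) (taken s 1ℚ c) + mass (contains v) (rest s 1ℚ c)  ≤⟨ +-mono-≤ fromT fromR ⟩
      mass (contains v) (merge t₁ t₂) + mass (contains v) M                 ≡⟨ sym (mass-++ (contains v) (merge t₁ t₂) M) ⟩
      mass (contains v) (merge t₁ t₂ ++ M)                                  ∎

  mergeAlong-covers : ∀ {Q₁ Q₂} S {c₁ c₂} → Unique S → Input Q₁ S c₁ → Input Q₂ S c₂ → ∀ {v} → v ∈ S →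
    1ℚ ≤ mass (contains v) (mergeAlong S c₁ c₂)
  mergeAlong-covers (s ∷ S) {c₁} {c₂} (s∉S ∷ uniq) I₁ I₂ {v} v∈s∷S =
    subst (1ℚ ≤_) (sym (mass-++ (contains v) (merge t₁ t₂) M)) (covered v∈s∷S)
    where
    open ≤-Reasoning
    t₁ t₂ M : WList n
    t₁ = taken s 1ℚ c₁
    t₂ = taken s 1ℚ c₂
    M = mergeAlong S (rest s 1ℚ c₁) (rest s 1ℚ c₂)
    covered : v ∈ s ∷ S → 1ℚ ≤ mass (contains v) (merge t₁ t₂) + mass (contains v) M
    covered (here refl) = begin
      1ℚ                                ≡⟨ sym (Split.taken-unit s∉S I₁) ⟩
      mass everything t₁                ≡⟨ sym (mass-all (contains s) t₁ (All.map (λ (_ , _ , Ts) → Ts) (Split.taken-through-s s∉S I₁))) ⟩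
      mass (contains s) t₁              ≤⟨ proj₁ (merge-weight t₁ t₂ s (Split.taken-through-s s∉S I₁) (Split.taken-through-s s∉S I₂)) ⟩
      mass (contains s) (merge t₁ t₂)   ≤⟨ ≤+nonnegʳ _ (mass-nonneg (contains s) (mergeAlong-nonneg S uniq (Split.rest-input s∉S I₁) (Split.rest-input s∉S I₂))) ⟩
      mass (contains s) (merge t₁ t₂) + mass (contains s) M ∎
    covered (there v∈S) = begin
      1ℚ                                ≤⟨ mergeAlong-covers S uniq (Split.rest-input s∉S I₁) (Split.rest-input s∉S I₂) v∈S ⟩
      mass (contains v) M               ≤⟨ ≤+nonnegˡ _ (mass-nonneg (contains v) (merge-nonneg t₁ t₂ (Split.taken-through-s s∉S I₁) (Split.taken-through-s s∉S I₂))) ⟩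
      mass (contains v) (merge t₁ t₂) + mass (contains v) M ∎

-- Reachability inside a vertex set W is decidable: a walk from x to y ≠ x leaves x along an
-- edge and then never needs to revisit x, so the question reduces to W ∖ {x}, which is
-- strictly smaller; we recurse on the well-founded subset order of Data.Fin.Subset.
module _ {G : Graph} where

  reach-source : ∀ {W x y} → Reach G W x y → W x ≡ true
  reach-source (here Wx)     = Wx
  reach-source (step r _ _) = reach-source r

  reach-target : ∀ {W x y} → Reach G W x y → W y ≡ true
  reach-target (here Wy)    = Wy
  reach-target (step _ _ Wy) = Wy

  reach-mono : ∀ {W W' x y} → W ⊆ W' → Reach G W x y → Reach G W' x y
  reach-mono W⊆W' (here Wx)      = here (W⊆W' _ Wx)
  reach-mono W⊆W' (step r e Wz) = step (reach-mono W⊆W' r) e (W⊆W' _ Wz)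

  reach-cons : ∀ {W x z y} → W x ≡ true → adj G x z ≡ true → Reach G W z y → Reach G W x y
  reach-cons Wx e (here Wz)      = step (here Wx) e Wz
  reach-cons Wx e (step r e' Wy) = step (reach-cons Wx e r) e' Wy

  reach-first-step : ∀ {W W' x y} → (∀ v → W v ≡ true → v ≢ x → W' v ≡ true) →
    Reach G W x y → x ≡ y ⊎ ∃ λ z → adj G x z ≡ true × Reach G W' z y
  reach-first-step keep (here _) = inj₁ refl
  reach-first-step {x = x} keep (step {z = z} r e Wz) with z ≟ x
  ... | yes z≡x = inj₁ (sym z≡x)
  ... | no z≢x with reach-first-step keep r
  ...   | inj₁ refl            = inj₂ (z , e , here (keep z Wz z≢x))
  ...   | inj₂ (z' , e' , r') = inj₂ (z' , e' , step r' e (keep z Wz z≢x))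

  private
    removal-⊆ : ∀ (p : Subset (size G)) x → lookup (p Subset.- x) ⊆ lookup p
    removal-⊆ p x v v∈p-x = []=⇒lookup (p─q⊆p p ⁅ x ⁆ (lookup⇒[]= v (p Subset.- x) v∈p-x))

    removal-keeps : ∀ (p : Subset (size G)) x v → lookup p v ≡ true → v ≢ x → lookup (p Subset.- x) v ≡ true
    removal-keeps p x v v∈p v≢x =
      []=⇒lookup (x∈p∧x∉q⇒x∈p─q (lookup⇒[]= v p v∈p) (v≢x ∘ x∈⁅y⁆⇒x≡y x))

  reach-dec : (p : Subset (size G)) → Acc Subset._⊂_ p → ∀ x y → Dec (Reach G (lookup p) x y)
  reach-dec p (acc smaller) x y with lookup p x in x∈p
  ... | false = no λ r → true≢false (trans (sym (reach-source r)) x∈p)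
  ... | true with x ≟ y
  ...   | yes refl = yes (here x∈p)
  ...   | no x≢y = map′ viaNeighbour firstStep
                        (any-vertex? λ z → (adj G x z ≟ᵇ true) ×-dec reach-dec (p Subset.- x) (smaller p-x⊂p) z y)
    where
    p-x⊂p : p Subset.- x Subset.⊂ p
    p-x⊂p = x∈p⇒p-x⊂p (lookup⇒[]= x p x∈p)
    viaNeighbour : (∃ λ z → adj G x z ≡ true × Reach G (lookup (p Subset.- x)) z y) → Reach G (lookup p) x y
    viaNeighbour (z , e , r) = reach-cons x∈p e (reach-mono (removal-⊆ p x) r)
    firstStep : Reach G (lookup p) x y → ∃ λ z → adj G x z ≡ true × Reach G (lookup (p Subset.- x)) z y
    firstStep r with reach-first-step (removal-keeps p x) r
    ... | inj₁ x≡y = ⊥-elim (x≢y x≡y)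
    ... | inj₂ viaZ = viaZ

  reach? : ∀ W x y → Dec (Reach G W x y)
  reach? W x y = map′ (reach-mono toW) (reach-mono fromW) (reach-dec (tabulate W) (⊂-wellFounded _) x y)
    where
    toW : lookup (tabulate W) ⊆ W
    toW v v∈W = trans (sym (lookup∘tabulate W v)) v∈W
    fromW : W ⊆ lookup (tabulate W)
    fromW v v∈W = trans (lookup∘tabulate W v) v∈W

induced : (G : Graph) → VSet (size G) → ESet (size G)
induced G V a b = V a ∧ (V b ∧ adj G a b)

induced-isSubgraph : ∀ G V → IsSubgraph G V (induced G V)
induced-isSubgraph G V = symmetric , endpoints , edges
  where
  symmetric : ∀ a b → induced G V a b ≡ induced G V b a
  symmetric a b rewrite Graph.sym G a b with V a | V b
  ... | true  | true  = refl
  ... | true  | false = refl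
  ... | false | true  = refl
  ... | false | false = refl
  endpoints : ∀ a b → induced G V a b ≡ true → V a ≡ true × V b ≡ true
  endpoints a b _ with V a | V b
  endpoints a b () | false | _
  endpoints a b () | true | false
  ... | true | true = refl , refl
  edges : ∀ a b → induced G V a b ≡ true → adj G a b ≡ true
  edges a b _ with V a | V b
  edges a b () | false | _
  edges a b () | true | false
  edges a b e | true | true = e

independent-down : ∀ {n} {V : VSet n} {E} → DownClosed (Independent V E)
independent-down T'⊆T (T⊆V , noEdge) =
  (λ v T'v → T⊆V v (T'⊆T v T'v)) , (λ a b T'a T'b → noEdge a b (T'⊆T a T'a) (T'⊆T b T'b))

independent-∪-comm : ∀ {n} {V : VSet n} {E} T T' → Independent V E (T ∪ T') → Independent V E (T' ∪ T)
independent-∪-comm T T' (T∪T'⊆V , noEdge) =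
  (λ v h → T∪T'⊆V v (swap v h)) , (λ a b ha hb → noEdge a b (swap a ha) (swap b hb))
  where
  swap : ∀ v → T' v ∨ T v ≡ true → T v ∨ T' v ≡ true
  swap v h = trans (∨-comm (T v) (T' v)) h

induced-independent : ∀ {G V T} → Independent V (induced G V) T → Independent allV (adj G) T
induced-independent {G} {V} {T} (T⊆V , noEdge) = (λ _ _ → refl) , independent
  where
  independent : ∀ a b → T a ≡ true → T b ≡ true → adj G a b ≡ false
  independent a b Ta Tb with noEdge a b Ta Tb
  ... | noInduced rewrite T⊆V a Ta | T⊆V b Tb = noInduced

IsClique : (G : Graph) → List (Fin (size G)) → Set
IsClique G S = ∀ {a b} → a ∈ S → b ∈ S → a ≢ b → adj G a b ≡ true

independent-once : ∀ {G S T} → IsClique G S → Independent allV (adj G) T → AtMostOnce S T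
independent-once {G} clique (_ , noEdge) {a} {b} a∈S b∈S Ta Tb with a ≟ b
... | yes a≡b = a≡b
... | no a≢b  = ⊥-elim (true≢false (trans (sym (clique a∈S b∈S a≢b)) (noEdge a b Ta Tb)))

∨-cases : ∀ a b → a ∨ b ≡ true → a ≡ true ⊎ b ≡ true
∨-cases true  _ _  = inj₁ refl
∨-cases false _ ab = inj₂ ab

colour-covers : ∀ {n} {V : VSet n} {E c v} → FracColoring V E c → V v ≡ true → 1ℚ ≤ mass (contains v) c
colour-covers {c = c} {v} (_ , covers) Vv = subst (1ℚ ≤_) (weightAt≡mass c v) (covers v Vv)

colouring-input : ∀ {G S V c} → IsClique G S → (∀ {v} → v ∈ S → V v ≡ true) →
  FracColoring V (induced G V) c → Input (Independent V (induced G V)) S c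
colouring-input {G} {V = V} clique S⊆V colouring = record
  { down   = independent-down {V = V} {E = induced G V}
  ; once   = λ independent → independent-once {G} clique (induced-independent {G} independent)
  ; family = proj₁ colouring
  ; covers = λ v∈S → colour-covers colouring (S⊆V v∈S)
  }

module CliqueCut (G : Graph) (critical : FractionallyCritical G)
  (S : List (Fin (size G))) (unique : Unique S) (clique : IsClique G S)
  (W : VSet (size G)) (W-is-G−S : ∀ v → (W v ≡ true) ⇔ (v ∉ S))
  (x y : Fin (size G)) (Wx : W x ≡ true) (Wy : W y ≡ true) (x↛y : ¬ Reach G W x y) where

  W-outside : ∀ {v} → v ∉ S → W v ≡ true
  W-outside v∉S = Equivalence.from (W-is-G−S _) v∉S

  W-on-S : ∀ {v} → v ∈ S → W v ≡ false
  W-on-S {v} v∈S with W v in Wv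
  ... | false = refl
  ... | true  = ⊥-elim (Equivalence.to (W-is-G−S v) Wv v∈S)

  R : VSet (size G)
  R v = ⌊ reach? {G} W x v ⌋

  R-sound : ∀ {v} → R v ≡ true → Reach G W x v
  R-sound {v} Rv = toWitness {a? = reach? {G} W x v} (Equivalence.from T-≡ Rv)

  R-complete : ∀ {v} → Reach G W x v → R v ≡ true
  R-complete {v} x⇝v = Equivalence.to T-≡ (fromWitness {a? = reach? {G} W x v} x⇝v)

  A B : VSet (size G)
  A v = not (W v) ∨ R v
  B v = not (R v)

  R⊆A : ∀ {v} → R v ≡ true → A v ≡ true
  R⊆A {v} Rv = trans (cong (not (W v) ∨_) Rv) (∨-zeroʳ (not (W v)))

  R-on-S : ∀ {v} → v ∈ S → R v ≡ false
  R-on-S {v} v∈S with R v in Rv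
  ... | false = refl
  ... | true  = ⊥-elim (true≢false (trans (sym (reach-target (R-sound Rv))) (W-on-S v∈S)))

  S⊆A : ∀ {v} → v ∈ S → A v ≡ true
  S⊆A v∈S rewrite W-on-S v∈S = refl

  S⊆B : ∀ {v} → v ∈ S → B v ≡ true
  S⊆B v∈S rewrite R-on-S v∈S = refl

  y∉A : A y ≡ false
  y∉A with R y in Ry
  ... | false = cong (λ w → not w ∨ false) Wy
  ... | true  = ⊥-elim (x↛y (R-sound Ry))

  x∉B : B x ≡ false
  x∉B rewrite R-complete (here Wx) = refl

  no-cross-edge : ∀ {a b} → a ∉ S → b ∉ S → A a ≡ true → B b ≡ true → adj G a b ≡ false
  no-cross-edge {a} {b} a∉S b∉S Aa Bb with adj G a b in ab
  ... | false = refl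
  ... | true  = ⊥-elim (true≢false (trans (sym Bb) (cong not Rb)))
    where
    Ra : R a ≡ true
    Ra = trans (sym (cong (λ w → not w ∨ R a) (W-outside a∉S))) Aa
    Rb : R b ≡ true
    Rb = R-complete (step (R-sound Ra) ab (W-outside b∉S))

  -- an edge between the two sides would pass through S, where the two sets agree
  glue : ∀ {T₁ T₂} → Independent A (induced G A) T₁ → Independent B (induced G B) T₂ → Agree S T₁ T₂ →
    Independent allV (adj G) (T₁ ∪ T₂)
  glue {T₁} {T₂} ind₁ ind₂ agree = (λ _ _ → refl) , noEdge
    where
    noEdge₁ : ∀ a b → T₁ a ≡ true → T₁ b ≡ true → adj G a b ≡ false
    noEdge₁ = proj₂ (induced-independent {G} ind₁)
    noEdge₂ : ∀ a b → T₂ a ≡ true → T₂ b ≡ true → adj G a b ≡ false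
    noEdge₂ = proj₂ (induced-independent {G} ind₂)
    cross : ∀ a b → T₁ a ≡ true → T₂ b ≡ true → adj G a b ≡ false
    cross a b T₁a T₂b with any? (a ≟_) S | any? (b ≟_) S
    ... | yes a∈S | _        = noEdge₂ a b (trans (sym (agree a∈S)) T₁a) T₂b
    ... | no _    | yes b∈S = noEdge₁ a b T₁a (trans (agree b∈S) T₂b)
    ... | no a∉S  | no b∉S  = no-cross-edge a∉S b∉S (proj₁ ind₁ a T₁a) (proj₁ ind₂ b T₂b)
    noEdge : ∀ a b → T₁ a ∨ T₂ a ≡ true → T₁ b ∨ T₂ b ≡ true → adj G a b ≡ false
    noEdge a b Ta Tb with ∨-cases (T₁ a) (T₂ a) Ta | ∨-cases (T₁ b) (T₂ b) Tb
    ... | inj₁ T₁a | inj₁ T₁b = noEdge₁ a b T₁a T₁b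
    ... | inj₁ T₁a | inj₂ T₂b = cross a b T₁a T₂b
    ... | inj₂ T₂a | inj₁ T₁b = trans (Graph.sym G a b) (cross b a T₁b T₂a)
    ... | inj₂ T₂a | inj₂ T₂b = noEdge₂ a b T₂a T₂b

  side₁ : χfLess A (induced G A) allV (adj G)
  side₁ = critical A (induced G A) (induced-isSubgraph G A) (inj₁ (y , y∉A))
  side₂ : χfLess B (induced G B) allV (adj G)
  side₂ = critical B (induced G B) (induced-isSubgraph G B) (inj₁ (x , x∉B))
  c₁ c₂ : WList (size G)
  c₁ = proj₁ side₁
  c₂ = proj₁ side₂

  I₁ : Input (Independent A (induced G A)) S c₁
  I₁ = colouring-input {G} clique S⊆A (proj₁ (proj₂ side₁))

  I₂ : Input (Independent B (induced G B)) S c₂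
  I₂ = colouring-input {G} clique S⊆B (proj₁ (proj₂ side₂))

  merged : WList (size G)
  merged = mergeAlong S c₁ c₂

  -- vertices of S are covered by their blocks; any other vertex lies in R ⊆ A (covered by
  -- c₁) or outside R, in B (covered by c₂), and the merge only adds weight to it
  merged-covers : ∀ v → 1ℚ ≤ mass (contains v) merged
  merged-covers v with any? (v ≟_) S
  ... | yes v∈S = mergeAlong-covers S unique I₁ I₂ v∈S
  ... | no v∉S with R v in Rv
  ...   | true  = ≤-trans (colour-covers (proj₁ (proj₂ side₁)) (R⊆A Rv))
                          (proj₁ (mergeAlong-weight S unique I₁ I₂ v∉S))
  ...   | false = ≤-trans (colour-covers (proj₁ (proj₂ side₂)) (cong not Rv))
                          (proj₂ (mergeAlong-weight S unique I₁ I₂ v∉S))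

  merged-colours : FracColoring allV (adj G) merged
  merged-colours = independent-sets , λ v _ → subst (1ℚ ≤_) (sym (weightAt≡mass merged v)) (merged-covers v)
    where
    independent-sets : Family (Independent allV (adj G)) merged
    independent-sets = mergeAlong-family S unique I₁ I₂ (independent-∪-comm {V = allV} {adj G})
      (λ _ → induced-independent {G}) (λ _ → induced-independent {G}) (λ _ _ → glue)

  t₁ t₂ : ℚ
  t₁ = mass everything c₁
  t₂ = mass everything c₂

  merged-light : mass everything merged ≤ t₁ ⊔ t₂
  merged-light = mergeAlong-total S unique I₁ I₂ (t₁ ⊔ t₂) (p≤p⊔q t₁ t₂) (p≤q⊔p t₁ t₂)

  lighter₁ : t₁ < mass everything merged
  lighter₁ = subst₂ _<_ (totalWeight≡mass c₁) (totalWeight≡mass merged) (proj₂ (proj₂ side₁) merged merged-colours)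

  lighter₂ : t₂ < mass everything merged
  lighter₂ = subst₂ _<_ (totalWeight≡mass c₂) (totalWeight≡mass merged) (proj₂ (proj₂ side₂) merged merged-colours)

  absurd : ⊥
  absurd with ⊔-sel t₁ t₂
  ... | inj₁ max≡t₁ = <-irrefl refl (<-≤-trans lighter₁ (subst (mass everything merged ≤_) max≡t₁ merged-light))
  ... | inj₂ max≡t₂ = <-irrefl refl (<-≤-trans lighter₂ (subst (mass everything merged ≤_) max≡t₂ merged-light))

no-clique-cutset : ∀ G → FractionallyCritical G → ∀ S → Unique S → IsClique G S →
  ∀ W → (∀ v → (W v ≡ true) ⇔ (v ∉ S)) → ConnectedOn G W
no-clique-cutset G critical S unique clique W W-is-G−S x y Wx Wy with reach? {G} W x y
... | yes x⇝y = x⇝y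
... | no x↛y  = ⊥-elim (CliqueCut.absurd G critical S unique clique W W-is-G−S x y Wx Wy x↛y)

singleton-clique : ∀ {G x} → IsClique G (x ∷ [])
singleton-clique (here refl) (here refl) a≢b = ⊥-elim (a≢b refl)

edge-clique : ∀ {G u v} → adj G u v ≡ true → IsClique G (u ∷ v ∷ [])
edge-clique uv (here refl) (here refl) a≢b = ⊥-elim (a≢b refl)
edge-clique uv (here refl) (there (here refl)) _ = uv
edge-clique {G} {u} {v} uv (there (here refl)) (here refl) _ = trans (Graph.sym G v u) uv
edge-clique uv (there (here refl)) (there (here refl)) a≢b = ⊥-elim (a≢b refl)

without-one : ∀ {n} (x y : Fin n) → (not ⌊ x ≟ y ⌋ ≡ true) ⇔ (y ∉ x ∷ [])
without-one x y with x ≟ y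
... | yes refl = mk⇔ (λ ()) (λ y∉[y] → ⊥-elim (y∉[y] (here refl)))
... | no x≢y   = mk⇔ (λ { _ (here y≡x) → x≢y (sym y≡x) }) (λ _ → refl)

without-two : ∀ G (u v y : Fin (size G)) → (minus2 G u v y ≡ true) ⇔ (y ∉ u ∷ v ∷ [])
without-two G u v y with u ≟ y | v ≟ y
... | yes refl | _        = mk⇔ (λ ()) (λ y∉ → ⊥-elim (y∉ (here refl)))
... | no _     | yes refl = mk⇔ (λ ()) (λ y∉ → ⊥-elim (y∉ (there (here refl))))
... | no u≢y   | no v≢y   = mk⇔ (λ { _ (here y≡u) → u≢y (sym y≡u) ; _ (there (here y≡v)) → v≢y (sym y≡v) }) (λ _ → refl)

lemma6 : (G : Graph) → FractionallyCritical G →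
    χfAtLeast allV (adj G) (1ℚ + 1ℚ) →
    TwoConnected G × (∀ u v → IsVertexCut2 G u v → adj G u v ≡ false)
lemma6 G critical _ = (connected , no-cut-vertex) , cut-pair-nonadjacent
  where
  connected : ConnectedOn G allV
  connected = no-clique-cutset G critical [] [] (λ ()) allV (λ _ → mk⇔ (λ _ ()) (λ _ → refl))

  no-cut-vertex : ∀ x → ConnectedOn G (λ y → not ⌊ x ≟ y ⌋)
  no-cut-vertex x = no-clique-cutset G critical (x ∷ []) ([] ∷ []) (singleton-clique {G}) _ (without-one x)

  cut-pair-nonadjacent : ∀ u v → IsVertexCut2 G u v → adj G u v ≡ false
  cut-pair-nonadjacent u v (u≢v , disconnected) with adj G u v in uv
  ... | false = refl
  ... | true  = ⊥-elim (disconnected (no-clique-cutset G critical (u ∷ v ∷ []) ((u≢v ∷ []) ∷ [] ∷ [])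
                                         (edge-clique {G} uv) (minus2 G u v) (without-two G u v)))
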